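{- Let $k\geq 2$ be an integer. Define numbers $r_{n,m}$ for integers $n,m\geq 0$ by \[ r_{n,0}=1 \ (n\ge 0),\qquad r_{n,m}=0 \ \text{ for } m>\tfrac{n}{k-1},\qquad r_{n,m}=r_{n,m-1}+(m+1)\,r_{n-1,m}\ \text{ for } 1\le m\le \tfrac{n}{k-1}. \] Then $r_{n,m}$ equals the number of horizontally $k$-decorated paths ending at $(n,m)$, and the number of relaxed $k$-ary trees with $n$ internal nodes equals $r_{(k-1)n,n}$.
   Context: An ordered DAG is a finite directed acyclic graph in which the outgoing edges of each node carry a left-to-right order (multiple edges allowed). A relaxed $k$-ary tree is an ordered DAG with a unique source and a unique sink in which every node other than the sink has out-degree exactly $k$; they are counted up to isomorphism of ordered DAGs. Internal nodes are all nodes except the sink. A horizontally $k$-decorated path is a lattice path starting at $(0,-1)$ with steps $U=(0,1)$ and $H=(1,0)$, together with decorations, such that: the first step is a $U$ step, and after removing it the remaining path (starting at $(0,0)$) never crosses the line $y=\frac{x}{k-1}$; and below each $H$ step there is exactly one cross placed in one of the unit boxes of the column of this $H$ step lying between the line $y=-1$ and the $H$ step (so an $H$ step at height $y$ has $y+1$ possible decorations). -}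

module Defs where

open import Data.Nat using (ℕ; zero; suc; _+_; _*_; _∸_; _≤_; _<_)
open import Data.Fin using (Fin)
open import Data.List using (List; []; _∷_; length; map)
open import Data.List.Membership.Propositional using (_∈_)
open import Data.Product using (Σ; _×_; _,_; ∃)
open import Data.Empty using (⊥)
open import Relation.Nullary using (¬_)
open import Relation.Binary.PropositionalEquality using (_≡_)
open import Relation.Binary.Construct.Closure.Transitive using (TransClosure)
open import Function.Bundles using (_↔_; Inverse)

-- A step is U = (0,1) or H = (1,0) carrying its decoration.
-- H c : the cross is in the c-th unit box (counted from the bottom,
-- starting at c = 0 for the box between y = -1 and y = 0) of the
-- column of this H step.
data Step : Set where
  U : Step
  H : ℕ → Step

ValidFrom : ℕ → ℕ → ℕ → List Step → ℕ → ℕ → Set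
ValidFrom k x y []          n m = (k ∸ 1) * y ≤ x × x ≡ n × y ≡ m
ValidFrom k x y (U ∷ s)     n m = (k ∸ 1) * y ≤ x × ValidFrom k x (suc y) s n m
ValidFrom k x y (H c ∷ s)   n m = (k ∸ 1) * y ≤ x × c ≤ y × ValidFrom k (suc x) y s n m

-- A horizontally k-decorated path ending at (n,m): the full step sequence
-- starting at (0,-1); its first step is U (leading to (0,0)), and the
-- remaining path starting at (0,0) satisfies the conditions above.
IsHDPath : ℕ → ℕ → ℕ → List Step → Set
IsHDPath k n m []          = ⊥
IsHDPath k n m (U ∷ rest)  = ValidFrom k 0 0 rest n m
IsHDPath k n m (H _ ∷ _)   = ⊥

HDPath : ℕ → ℕ → ℕ → Set
HDPath k n m = Σ (List Step) (IsHDPath k n m)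

-- An ordered directed (multi)graph on the node set Fin V: each node has
-- a left-to-right ordered list of outgoing edges, given by their targets
-- (repetitions = multiple edges).
OrderedGraph : ℕ → Set
OrderedGraph V = Fin V → List (Fin V)

module _ {V : ℕ} (G : OrderedGraph V) where

  Edge : Fin V → Fin V → Set
  Edge u v = v ∈ G u

  IsAcyclic : Set
  IsAcyclic = ∀ u → ¬ TransClosure Edge u u

  IsSource : Fin V → Set
  IsSource v = ∀ u → ¬ Edge u v

  IsSink : Fin V → Set
  IsSink v = G v ≡ []

  record IsRelaxedTree (k : ℕ) : Set where
    field
      acyclic      : IsAcyclic
      source       : Fin V
      isSource     : IsSource source
      sourceUnique : ∀ v → IsSource v → v ≡ source
      sink         : Fin V
      isSink       : IsSink sink
      sinkUnique   : ∀ v → IsSink v → v ≡ sink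
      outDegree    : ∀ v → ¬ (v ≡ sink) → length (G v) ≡ k

-- A relaxed k-ary tree with n internal nodes: since the sink is unique,
-- the internal nodes are all nodes but one, so the node set is Fin (suc n).
RelaxedTree : ℕ → ℕ → Set
RelaxedTree k n = Σ (OrderedGraph (suc n)) (λ G → IsRelaxedTree G k)

_≅_ : ∀ {k n} → RelaxedTree k n → RelaxedTree k n → Set
_≅_ {n = n} (G , _) (G' , _) =
  Σ (Fin (suc n) ↔ Fin (suc n)) λ φ →
    ∀ v → G' (Inverse.to φ v) ≡ map (Inverse.to φ) (G v)

-- "The number of isomorphism classes of relaxed k-ary trees with n
-- internal nodes is N": a family of N trees meeting every class exactly once.
NumberOfClasses : ℕ → ℕ → ℕ → Set
NumberOfClasses k n N =
  Σ (Fin N → RelaxedTree k n) λ f →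
    (∀ T → ∃ λ i → T ≅ f i) × (∀ i j → f i ≅ f j → i ≡ j)

-- Read backwards, a horizontally decorated path ending at height m > 0 ends either with a
-- U step or with one of the m + 1 decorations of an H step, which is the recursion for r.
-- A relaxed tree is encoded by the depth-first traversal from its source that emits U
-- when a node is finished and H i for an edge to the i-th node finished so far.  The
-- first node finished is the sink and every other node has k children, so a stack
-- of the edge targets still waiting for their parent has height x - (k - 1) y + 1 at the
-- point (x, y) of the output: the output is a decorated path to ((k - 1) n, n).  A stack
-- machine inverts the traversal, which commutes with isomorphisms, so the path is a
-- complete isomorphism invariant taking every value exactly once.

module Submission where

open import Defs
open import Data.Nat using (ℕ; zero; suc; _+_; _*_; _∸_; _≤_; _<_; z≤n; s≤s; _≤?_)
open import Data.Nat.Properties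
open import Data.Fin using (Fin; zero; suc; toℕ; fromℕ<)
import Data.Fin as F
open import Data.Fin.Properties
  using (pigeonhole; any?; toℕ-injective; toℕ<n; toℕ-fromℕ<; fromℕ<-toℕ; fromℕ<-injective; +↔⊎; *↔×; 0↔⊥; 1↔⊤)
open import Data.List using (List; []; _∷_; _++_; [_]; length; map; reverse; _ʳ++_; take; drop; applyUpTo)
open import Data.List.Properties
  using ( reverse-involutive; unfold-reverse; ʳ++-defn; ++-assoc; ++-identityʳ; map-++; map-∘
        ; length-++; length-map; length-reverse; length-take; length-drop; take++drop≡id
        ; applyUpTo-∷ʳ; length-applyUpTo)
open import Data.List.Relation.Unary.Any using (here; there)
import Data.List.Relation.Unary.Any as Any
open import Data.List.Relation.Unary.Any.Properties using (reverse⁺; reverse⁻)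
open import Data.List.Relation.Unary.All using ([])
open import Data.List.Relation.Unary.All.Properties using (All¬⇒¬Any)
open import Data.List.Relation.Unary.AllPairs using ([]; _∷_)
open import Data.List.Relation.Unary.Unique.Propositional using (Unique)
import Data.List.Relation.Unary.Unique.Propositional.Properties as Unique
open import Data.List.Membership.Propositional using (_∈_; _∉_)
open import Data.List.Membership.Propositional.Properties
  using (∈-++⁺ˡ; ∈-++⁺ʳ; ∈-++⁻; ∈-map⁺; ∈-map⁻; ∈-applyUpTo⁺; ∈-applyUpTo⁻)
open import Data.Product using (Σ; _×_; _,_; proj₁; proj₂; ∃; ∃₂)
open import Data.Product.Function.NonDependent.Propositional using (_×-↔_)
open import Data.Sum using (_⊎_; inj₁; inj₂; map₁)
open import Data.Sum.Function.Propositional using (_⊎-↔_)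
open import Data.Unit using (⊤)
open import Data.Empty using (⊥; ⊥-elim)
open import Relation.Nullary using (¬_; Dec; yes; no; Irrelevant)
open import Relation.Binary.PropositionalEquality
  using (_≡_; _≢_; refl; sym; trans; cong; cong₂; subst; module ≡-Reasoning)
open import Function.Base using (_∘_; flip)
open import Function.Definitions using (Injective)
open import Induction.WellFounded using (WellFounded; Acc; acc)
open import Relation.Binary.Construct.Closure.Transitive
  using (TransClosure) renaming ([_] to [_]⁺; _∷_ to _∷⁺_; _++_ to _++⁺_)
open import Function.Bundles using (_↔_; mk↔ₛ′; Inverse; Injection)
open import Function.Properties.Inverse using (↔-refl; ↔-sym; ↔-trans; ↔⇒↣)

Σ-≡-irrelevant : {A : Set} {P : A → Set} → (∀ a → Irrelevant (P a)) →
                 {p q : Σ A P} → proj₁ p ≡ proj₁ q → p ≡ q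
Σ-≡-irrelevant irr {a , p} {.a , q} refl = cong (a ,_) (irr a p q)

Fin-≡↔ : ∀ {m n} → m ≡ n → Fin m ↔ Fin n
Fin-≡↔ refl = ↔-refl

clamp : ∀ n → ℕ → Fin (suc n)
clamp zero    _       = zero
clamp (suc n) zero    = zero
clamp (suc n) (suc i) = suc (clamp n i)

toℕ-clamp : ∀ n {i} → i ≤ n → toℕ (clamp n i) ≡ i
toℕ-clamp zero    z≤n       = refl
toℕ-clamp (suc n) z≤n       = refl
toℕ-clamp (suc n) (s≤s i≤n) = cong suc (toℕ-clamp n i≤n)

clamp-toℕ : ∀ n (x : Fin (suc n)) → clamp n (toℕ x) ≡ x
clamp-toℕ zero    zero    = refl
clamp-toℕ (suc n) zero    = refl
clamp-toℕ (suc n) (suc x) = cong suc (clamp-toℕ n x)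

take-length-++ : ∀ {A : Set} (xs ys : List A) → take (length xs) (xs ++ ys) ≡ xs
take-length-++ []       ys = refl
take-length-++ (x ∷ xs) ys = cong (x ∷_) (take-length-++ xs ys)

drop-length-++ : ∀ {A : Set} (xs ys : List A) → drop (length xs) (xs ++ ys) ≡ ys
drop-length-++ []       ys = refl
drop-length-++ (x ∷ xs) ys = drop-length-++ xs ys

reverse-∷-++ : ∀ {A : Set} (x : A) xs ys → reverse (x ∷ xs) ++ ys ≡ reverse xs ++ x ∷ ys
reverse-∷-++ x xs ys = trans (sym (ʳ++-defn (x ∷ xs))) (ʳ++-defn xs)

∈-take : ∀ {A : Set} {x : A} i xs → x ∈ take i xs → x ∈ xs
∈-take (suc i) (y ∷ xs) (here x≡y)  = here x≡y
∈-take (suc i) (y ∷ xs) (there x∈)  = there (∈-take i xs x∈)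

∈-drop : ∀ {A : Set} {x : A} i xs → x ∈ drop i xs → x ∈ xs
∈-drop zero    xs       x∈ = x∈
∈-drop (suc i) (y ∷ xs) x∈ = there (∈-drop i xs x∈)

∈-take⊎drop : ∀ {A : Set} {x : A} i xs → x ∈ xs → x ∈ take i xs ⊎ x ∈ drop i xs
∈-take⊎drop i xs x∈ = ∈-++⁻ (take i xs) (subst (_ ∈_) (sym (take++drop≡id i xs)) x∈)

length-∷ʳ : ∀ {A : Set} (xs : List A) x → length (xs ++ [ x ]) ≡ suc (length xs)
length-∷ʳ xs x = trans (length-++ xs) (+-comm (length xs) 1)

flip⁺ : ∀ {A : Set} {R : A → A → Set} {x y} → TransClosure (flip R) x y → TransClosure R y x
flip⁺ [ e ]⁺   = [ e ]⁺
flip⁺ (e ∷⁺ t) = flip⁺ t ++⁺ [ e ]⁺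

-- Paths and the recursion

module Paths (j : ℕ) where

  k : ℕ
  k = suc (suc j)

  -- A path given by its steps in reverse order, from its endpoint (n, m)
  -- back to (0, 0).  The line condition only needs checking after U steps.
  BackwardPath : List Step → ℕ → ℕ → Set
  BackwardPath []        n       m       = n ≡ 0 × m ≡ 0
  BackwardPath (U ∷ t)   n       zero    = ⊥
  BackwardPath (U ∷ t)   n       (suc m) = suc j * suc m ≤ n × BackwardPath t n m
  BackwardPath (H c ∷ t) zero    m       = ⊥
  BackwardPath (H c ∷ t) (suc n) m       = c ≤ m × BackwardPath t n m

  BackwardPaths : ℕ → ℕ → Set
  BackwardPaths n m = Σ (List Step) λ t → BackwardPath t n m

  backward-belowLine : ∀ t {n m} → BackwardPath t n m → suc j * m ≤ n
  backward-belowLine []        (refl , refl) = ≤-reflexive (*-zeroʳ (suc j))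
  backward-belowLine (U ∷ t)   {m = suc m} (below , _) = below
  backward-belowLine (H c ∷ t) {suc n}     (_ , p)     = m≤n⇒m≤1+n (backward-belowLine t p)

  backward-endpoint-unique : ∀ t {x y x′ y′} → BackwardPath t x y → BackwardPath t x′ y′ →
                             x ≡ x′ × y ≡ y′
  backward-endpoint-unique [] (refl , refl) (refl , refl) = refl , refl
  backward-endpoint-unique (U ∷ t) {y = suc y} {y′ = suc y′} (_ , p) (_ , q)
    with refl , refl ← backward-endpoint-unique t p q = refl , refl
  backward-endpoint-unique (H c ∷ t) {suc x} {x′ = suc x′} (_ , p) (_ , q)
    with refl , refl ← backward-endpoint-unique t p q = refl , refl

  backward-tail : ∀ a t {n m} → BackwardPath (a ∷ t) n m → ∃₂ (BackwardPath t)
  backward-tail U     t {n} {suc m} (_ , p) = n , m , p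
  backward-tail (H c) t {suc n} {m} (_ , p) = n , m , p

  backward-suffix : ∀ s t {n m} → BackwardPath (s ʳ++ t) n m → ∃₂ (BackwardPath t)
  backward-suffix []      t p = _ , _ , p
  backward-suffix (a ∷ s) t p with _ , _ , q ← backward-suffix s (a ∷ t) p = backward-tail a t q

  backward-irrelevant : ∀ {n m} t → Irrelevant (BackwardPath t n m)
  backward-irrelevant [] (a , b) (c , d) = cong₂ _,_ (≡-irrelevant a c) (≡-irrelevant b d)
  backward-irrelevant {m = suc m} (U ∷ t) (a , b) (c , d) =
    cong₂ _,_ (≤-irrelevant a c) (backward-irrelevant t b d)
  backward-irrelevant {suc n} (H _ ∷ t) (a , b) (c , d) =
    cong₂ _,_ (≤-irrelevant a c) (backward-irrelevant t b d)

  validFrom-belowLine : ∀ s {x y n m} → ValidFrom k x y s n m → suc j * y ≤ x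
  validFrom-belowLine []        (below , _) = below
  validFrom-belowLine (U ∷ s)   (below , _) = below
  validFrom-belowLine (H c ∷ s) (below , _) = below

  validFrom-irrelevant : ∀ {x y n m} s → Irrelevant (ValidFrom k x y s n m)
  validFrom-irrelevant [] (a , b , c) (a′ , b′ , c′) =
    cong₂ _,_ (≤-irrelevant a a′) (cong₂ _,_ (≡-irrelevant b b′) (≡-irrelevant c c′))
  validFrom-irrelevant (U ∷ s) (a , b) (a′ , b′) =
    cong₂ _,_ (≤-irrelevant a a′) (validFrom-irrelevant s b b′)
  validFrom-irrelevant (H c ∷ s) (a , b , d) (a′ , b′ , d′) =
    cong₂ _,_ (≤-irrelevant a a′) (cong₂ _,_ (≤-irrelevant b b′) (validFrom-irrelevant s d d′))

  isHDPath-irrelevant : ∀ {n m} s → Irrelevant (IsHDPath k n m s)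
  isHDPath-irrelevant (U ∷ s) = validFrom-irrelevant s

  validFrom⇒backward : ∀ s t {x y n m} → BackwardPath t x y → ValidFrom k x y s n m →
                       BackwardPath (s ʳ++ t) n m
  validFrom⇒backward []        t p (_ , refl , refl) = p
  validFrom⇒backward (U ∷ s)   t p (_ , v) =
    validFrom⇒backward s (U ∷ t) (validFrom-belowLine s v , p) v
  validFrom⇒backward (H c ∷ s) t p (_ , c≤y , v) =
    validFrom⇒backward s (H c ∷ t) (c≤y , p) v

  backward⇒validFrom : ∀ s t {x y n m} → BackwardPath t x y → BackwardPath (s ʳ++ t) n m →
                       ValidFrom k x y s n m
  backward⇒validFrom [] t p q with refl , refl ← backward-endpoint-unique t p q =
    backward-belowLine t p , refl , refl
  backward⇒validFrom (U ∷ s) t {x} {y} p q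
    with _ , suc _ , (below , p′) ← backward-suffix s (U ∷ t) q
    with refl , refl ← backward-endpoint-unique t p p′ =
    backward-belowLine t p , backward⇒validFrom s (U ∷ t) (below , p) q
  backward⇒validFrom (H c ∷ s) t p q
    with suc _ , _ , (c≤y , p′) ← backward-suffix s (H c ∷ t) q
    with refl , refl ← backward-endpoint-unique t p p′ =
    backward-belowLine t p , c≤y , backward⇒validFrom s (H c ∷ t) (c≤y , p) q

  HDPath↔BackwardPaths : ∀ n m → HDPath k n m ↔ BackwardPaths n m
  HDPath↔BackwardPaths n m = mk↔ₛ′ to from to∘from from∘to
    where
    to : HDPath k n m → BackwardPaths n m
    to (U ∷ s , v) = reverse s , validFrom⇒backward s [] (refl , refl) v

    from : BackwardPaths n m → HDPath k n m
    from (t , p) = U ∷ reverse t , backward⇒validFrom (reverse t) [] (refl , refl)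
                                     (subst (λ t′ → BackwardPath t′ n m) (sym (reverse-involutive t)) p)

    to∘from : ∀ b → to (from b) ≡ b
    to∘from (t , _) = Σ-≡-irrelevant backward-irrelevant (reverse-involutive t)

    from∘to : ∀ a → from (to a) ≡ a
    from∘to (U ∷ s , _) = Σ-≡-irrelevant isHDPath-irrelevant (cong (U ∷_) (reverse-involutive s))

  horizontal : ℕ → List Step
  horizontal zero    = []
  horizontal (suc n) = H 0 ∷ horizontal n

  backward-horizontal : ∀ n → BackwardPath (horizontal n) n 0
  backward-horizontal zero    = refl , refl
  backward-horizontal (suc n) = z≤n , backward-horizontal n

  backward-height0 : ∀ t {n} → BackwardPath t n 0 → t ≡ horizontal n
  backward-height0 []        (refl , _)    = refl
  backward-height0 (H c ∷ t) {suc n} (z≤n , p) = cong (H 0 ∷_) (backward-height0 t p)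

  BackwardPaths-height0↔⊤ : ∀ n → BackwardPaths n 0 ↔ ⊤
  BackwardPaths-height0↔⊤ n = mk↔ₛ′ _ (λ _ → horizontal n , backward-horizontal n) (λ _ → refl)
    λ (t , p) → Σ-≡-irrelevant backward-irrelevant (sym (backward-height0 t p))

  BackwardPaths-aboveLine↔⊥ : ∀ {n m} → n < suc j * m → BackwardPaths n m ↔ ⊥
  BackwardPaths-aboveLine↔⊥ n<jm = mk↔ₛ′ escape (λ ()) (λ ()) (⊥-elim ∘ escape)
    where
    escape : BackwardPaths _ _ → ⊥
    escape (t , p) = <⇒≱ n<jm (backward-belowLine t p)

  -- The last step is U from (n+1, m), or one of the m + 2 decorated H steps from (n, m+1).
  BackwardPaths-step : ∀ n m → suc j * suc m ≤ suc n →
    BackwardPaths (suc n) (suc m) ↔ (BackwardPaths (suc n) m ⊎ (Fin (suc (suc m)) × BackwardPaths n (suc m)))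
  BackwardPaths-step n m below = mk↔ₛ′ to from to∘from from∘to
    where
    Split : Set
    Split = BackwardPaths (suc n) m ⊎ (Fin (suc (suc m)) × BackwardPaths n (suc m))

    to : BackwardPaths (suc n) (suc m) → Split
    to (U ∷ t , _ , p)       = inj₁ (t , p)
    to (H c ∷ t , c≤m , p) = inj₂ (fromℕ< (s≤s c≤m) , t , p)

    from : Split → BackwardPaths (suc n) (suc m)
    from (inj₁ (t , p))     = U ∷ t , below , p
    from (inj₂ (i , t , p)) = H (toℕ i) ∷ t , ≤-pred (toℕ<n i) , p

    to∘from : ∀ b → to (from b) ≡ b
    to∘from (inj₁ _)         = refl
    to∘from (inj₂ (i , t , p)) = cong (λ i → inj₂ (i , t , p)) (fromℕ<-toℕ i _)

    from∘to : ∀ a → from (to a) ≡ a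
    from∘to (U ∷ t , _ , _)   = Σ-≡-irrelevant backward-irrelevant refl
    from∘to (H c ∷ t , c≤m , _) =
      Σ-≡-irrelevant backward-irrelevant (cong (λ c → H c ∷ t) (toℕ-fromℕ< (s≤s c≤m)))

  module Counting (r : ℕ → ℕ → ℕ)
    (r-height0 : ∀ n → r n 0 ≡ 1)
    (r-aboveLine : ∀ n m → n < (k ∸ 1) * m → r n m ≡ 0)
    (r-step : ∀ n m → 1 ≤ m → (k ∸ 1) * m ≤ n → r n m ≡ r n (m ∸ 1) + (m + 1) * r (n ∸ 1) m) where

    Fin-r↔BackwardPaths : ∀ n m → Fin (r n m) ↔ BackwardPaths n m
    Fin-r↔BackwardPaths n zero =
      ↔-trans (Fin-≡↔ (r-height0 n)) (↔-trans 1↔⊤ (↔-sym (BackwardPaths-height0↔⊤ n)))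
    Fin-r↔BackwardPaths n (suc m) with suc j * suc m ≤? n
    ... | no above = ↔-trans (Fin-≡↔ (r-aboveLine n (suc m) (≰⇒> above)))
                       (↔-trans 0↔⊥ (↔-sym (BackwardPaths-aboveLine↔⊥ (≰⇒> above))))
    Fin-r↔BackwardPaths zero (suc m) | yes below = ⊥-elim (<⇒≱ (s≤s z≤n) below)
    Fin-r↔BackwardPaths (suc n) (suc m) | yes below =
      ↔-trans (Fin-≡↔ recurrence)
        (↔-trans +↔⊎
          (↔-trans (Fin-r↔BackwardPaths (suc n) m
                      ⊎-↔ ↔-trans *↔× (↔-refl ×-↔ Fin-r↔BackwardPaths n (suc m)))
                   (↔-sym (BackwardPaths-step n m below))))
      where
      recurrence : r (suc n) (suc m) ≡ r (suc n) m + suc (suc m) * r n (suc m)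
      recurrence = trans (r-step (suc n) (suc m) (s≤s z≤n) below)
                         (cong (λ c → r (suc n) m + c * r n (suc m)) (+-comm (suc m) 1))

    Fin-r↔HDPath : ∀ n m → Fin (r n m) ↔ HDPath k n m
    Fin-r↔HDPath n m = ↔-trans (Fin-r↔BackwardPaths n m) (↔-sym (HDPath↔BackwardPaths n m))

-- Acyclic relations on finite sets are well founded

module AcyclicWalks {V : ℕ} (R : Fin V → Fin V → Set) (acyclic : ∀ x → ¬ TransClosure R x x) where

  data Walk : ℕ → Fin V → Set where
    []  : ∀ {u} → Walk 0 u
    _∷_ : ∀ {u v ℓ} → R u v → Walk ℓ v → Walk (suc ℓ) u

  vertex : ∀ {ℓ u} → Walk ℓ u → Fin (suc ℓ) → Fin V
  vertex {u = u} w       zero    = u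
  vertex         (e ∷ w) (suc i) = vertex w i

  walk-segment : ∀ {ℓ u} (w : Walk ℓ u) i i′ → i F.< i′ → TransClosure R (vertex w i) (vertex w i′)
  walk-segment (e ∷ w) zero    (suc zero)     _     = [ e ]⁺
  walk-segment (e ∷ w) zero    (suc (suc i′)) _     = e ∷⁺ walk-segment w zero (suc i′) (s≤s z≤n)
  walk-segment (e ∷ w) (suc i) (suc i′)       i<i′  = walk-segment w i i′ (≤-pred i<i′)

  walk-length< : ∀ {ℓ u} → Walk ℓ u → ℓ < V
  walk-length< {ℓ} w with V ≤? ℓ
  ... | no  V≰ℓ = ≰⇒> V≰ℓ
  ... | yes V≤ℓ with i , i′ , i<i′ , same ← pigeonhole (s≤s V≤ℓ) (vertex w) =
    ⊥-elim (acyclic _ (subst (TransClosure R (vertex w i)) (sym same) (walk-segment w i i′ i<i′)))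

  acyclic⇒wellFounded : WellFounded (flip R)
  acyclic⇒wellFounded u = bounded⇒acc V u walk-length<
    where
    bounded⇒acc : ∀ b u → (∀ {ℓ} → Walk ℓ u → ℓ < b) → Acc (flip R) u
    bounded⇒acc zero    u bound = ⊥-elim (<-irrefl refl (bound []))
    bounded⇒acc (suc b) u bound = acc λ e → bounded⇒acc b _ (λ w → ≤-pred (bound (e ∷ w)))

-- Depth-first encoding of ordered graphs

module Encoding (n : ℕ) where

  Node : Set
  Node = Fin (suc n)

  _∈?_ : ∀ x (d : List Node) → Dec (x ∈ d)
  x ∈? d = Any.any? (x F.≟_) d

  indexOf : List Node → Node → ℕ
  indexOf []       x = 0
  indexOf (y ∷ ys) x with x F.≟ y
  ... | yes _ = 0
  ... | no  _ = suc (indexOf ys x)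

  indexOf-++ : ∀ d e {x} → x ∈ d → indexOf (d ++ e) x ≡ indexOf d x
  indexOf-++ (y ∷ ys) e {x} x∈d with x F.≟ y | x∈d
  ... | yes _  | _         = refl
  ... | no x≢y | here x≡y  = ⊥-elim (x≢y x≡y)
  ... | no _   | there x∈ys = cong suc (indexOf-++ ys e x∈ys)

  indexOf<length : ∀ d {x} → x ∈ d → indexOf d x < length d
  indexOf<length (y ∷ ys) {x} x∈d with x F.≟ y | x∈d
  ... | yes _  | _          = s≤s z≤n
  ... | no x≢y | here x≡y   = ⊥-elim (x≢y x≡y)
  ... | no _   | there x∈ys = s≤s (indexOf<length ys x∈ys)

  indexOf-∉ : ∀ d e {x} → x ∉ d → indexOf (d ++ x ∷ e) x ≡ length d
  indexOf-∉ []       e {x} _ with x F.≟ x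
  ... | yes _   = refl
  ... | no  x≢x = ⊥-elim (x≢x refl)
  indexOf-∉ (y ∷ ys) e {x} x∉d with x F.≟ y
  ... | yes x≡y = ⊥-elim (x∉d (here x≡y))
  ... | no  _   = cong suc (indexOf-∉ ys e (x∉d ∘ there))

  indexOf-map : ∀ (f : Node → Node) → Injective _≡_ _≡_ f → ∀ d x →
                indexOf (map f d) (f x) ≡ indexOf d x
  indexOf-map f inj []       x = refl
  indexOf-map f inj (y ∷ ys) x with f x F.≟ f y | x F.≟ y
  ... | yes _     | yes _   = refl
  ... | yes fx≡fy | no x≢y  = ⊥-elim (x≢y (inj fx≡fy))
  ... | no fx≢fy  | yes x≡y = ⊥-elim (fx≢fy (cong f x≡y))
  ... | no _      | no _    = cong suc (indexOf-map f inj ys x)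

  -- Indices beyond the end of the list are sent to an arbitrary node.
  nth : List Node → ℕ → Node
  nth []       _       = zero
  nth (x ∷ xs) zero    = x
  nth (x ∷ xs) (suc i) = nth xs i

  nth-indexOf : ∀ d {x} → x ∈ d → nth d (indexOf d x) ≡ x
  nth-indexOf (y ∷ ys) {x} x∈d with x F.≟ y | x∈d
  ... | yes x≡y | _          = sym x≡y
  ... | no x≢y  | here x≡y   = ⊥-elim (x≢y x≡y)
  ... | no _    | there x∈ys = nth-indexOf ys x∈ys

  nth∈ : ∀ d i → i < length d → nth d i ∈ d
  nth∈ (x ∷ d) zero    _   = here refl
  nth∈ (x ∷ d) (suc i) i<d = there (nth∈ d i (≤-pred i<d))

  indexOf-nth : ∀ d i → Unique d → i < length d → indexOf d (nth d i) ≡ i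
  indexOf-nth (x ∷ d) zero _ _ with x F.≟ x
  ... | yes _   = refl
  ... | no x≢x  = ⊥-elim (x≢x refl)
  indexOf-nth (x ∷ d) (suc i) (x∉d ∷ d!) i<d with nth d i F.≟ x
  ... | yes nth≡x = ⊥-elim (All¬⇒¬Any x∉d (subst (_∈ d) nth≡x (nth∈ d i (≤-pred i<d))))
  ... | no  _     = cong suc (indexOf-nth d i d! (≤-pred i<d))

  Unique-∷ʳ : ∀ {d : List Node} {x} → Unique d → x ∉ d → Unique (d ++ [ x ])
  Unique-∷ʳ d! x∉d = Unique.++⁺ d! ([] ∷ []) λ { (x∈d , here refl) → x∉d x∈d }

  map-indexOf-++ : ∀ d e cs → (∀ {c} → c ∈ cs → c ∈ d) → map (indexOf (d ++ e)) cs ≡ map (indexOf d) cs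
  map-indexOf-++ d e []       _   = refl
  map-indexOf-++ d e (c ∷ cs) cs⊆ =
    cong₂ _∷_ (indexOf-++ d e (cs⊆ (here refl))) (map-indexOf-++ d e cs (cs⊆ ∘ there))

  module Enumeration (D : List Node) (D! : Unique D) (all∈D : ∀ x → x ∈ D) where

    position : ∀ x → indexOf D x < length D
    position x = indexOf<length D (all∈D x)

    enumeration-length : length D ≡ suc n
    enumeration-length = ≤-antisym (≮⇒≥ longer) (≮⇒≥ shorter)
      where
      longer : ¬ suc n < length D
      longer n<D with i , i′ , i<i′ , same ← pigeonhole n<D (λ i → nth D (toℕ i)) =
        <⇒≢ i<i′ (begin
          toℕ i                        ≡⟨ indexOf-nth D (toℕ i) D! (toℕ<n i) ⟨
          indexOf D (nth D (toℕ i))    ≡⟨ cong (indexOf D) same ⟩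
          indexOf D (nth D (toℕ i′))   ≡⟨ indexOf-nth D (toℕ i′) D! (toℕ<n i′) ⟩
          toℕ i′                       ∎)
        where open ≡-Reasoning
      shorter : ¬ length D < suc n
      shorter D<n with x , y , x<y , same ← pigeonhole D<n (λ x → fromℕ< (position x)) =
        <⇒≢ x<y (cong toℕ (begin
          x                      ≡⟨ nth-indexOf D (all∈D x) ⟨
          nth D (indexOf D x)    ≡⟨ cong (nth D) (fromℕ<-injective _ _ (position x) (position y) same) ⟩
          nth D (indexOf D y)    ≡⟨ nth-indexOf D (all∈D y) ⟩
          y                      ∎))
        where open ≡-Reasoning

    indexOf≤n : ∀ x → indexOf D x ≤ n
    indexOf≤n x = ≤-pred (subst (indexOf D x <_) enumeration-length (position x))

    relabelling : Node ↔ Node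
    relabelling = mk↔ₛ′ (clamp n ∘ indexOf D) (λ i → nth D (toℕ i)) to∘from from∘to
      where
      to∘from : ∀ i → clamp n (indexOf D (nth D (toℕ i))) ≡ i
      to∘from i = trans (cong (clamp n) (indexOf-nth D (toℕ i) D! i<D)) (clamp-toℕ n i)
        where i<D = subst (toℕ i <_) (sym enumeration-length) (toℕ<n i)
      from∘to : ∀ x → nth D (toℕ (clamp n (indexOf D x))) ≡ x
      from∘to x = trans (cong (nth D) (toℕ-clamp n (indexOf≤n x))) (nth-indexOf D (all∈D x))

  -- Visit G v d d′ o: the depth-first traversal of G from v, started with the
  -- list d of already finished nodes, finishes the nodes d′ and outputs o.
  -- A node is finished, and U emitted, after all its children; an edge to an
  -- already finished node c emits H (indexOf d c).
  data Visit (G : OrderedGraph (suc n)) : Node → List Node → List Node → List Step → Set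
  data VisitAll (G : OrderedGraph (suc n)) : List Node → List Node → List Node → List Step → Set

  data Visit G where
    visit : ∀ {v d d′ o} → VisitAll G (G v) d d′ o → v ∉ d′ → Visit G v d (d′ ++ [ v ]) (o ++ [ U ])

  data VisitAll G where
    []     : ∀ {d} → VisitAll G [] d d []
    seen   : ∀ {c cs d d′ o} → c ∈ d → VisitAll G cs d d′ o →
             VisitAll G (c ∷ cs) d d′ (H (indexOf d c) ∷ o)
    unseen : ∀ {c cs d d₁ d₂ o₁ o₂} → c ∉ d → Visit G c d d₁ o₁ → VisitAll G cs d₁ d₂ o₂ →
             VisitAll G (c ∷ cs) d d₂ (o₁ ++ o₂)

  Closed : OrderedGraph (suc n) → List Node → Set
  Closed G d = ∀ {x c} → x ∈ d → c ∈ G x → c ∈ d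

  closed-⁺ : ∀ {G d x y} → Closed G d → x ∈ d → TransClosure (Edge G) x y → y ∈ d
  closed-⁺ closed x∈d [ e ]⁺   = closed x∈d e
  closed-⁺ closed x∈d (e ∷⁺ t) = closed-⁺ closed (closed x∈d e) t

  module _ {G : OrderedGraph (suc n)} where

    visit-deterministic : ∀ {v d d₁ d₂ o₁ o₂} → Visit G v d d₁ o₁ → Visit G v d d₂ o₂ →
                          d₁ ≡ d₂ × o₁ ≡ o₂
    visitAll-deterministic : ∀ {cs d d₁ d₂ o₁ o₂} → VisitAll G cs d d₁ o₁ → VisitAll G cs d d₂ o₂ →
                             d₁ ≡ d₂ × o₁ ≡ o₂
    visit-deterministic (visit a _) (visit b _) with refl , refl ← visitAll-deterministic a b = refl , refl
    visitAll-deterministic [] [] = refl , refl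
    visitAll-deterministic (seen _ a) (seen _ b) with refl , refl ← visitAll-deterministic a b = refl , refl
    visitAll-deterministic (seen c∈d _) (unseen c∉d _ _) = ⊥-elim (c∉d c∈d)
    visitAll-deterministic (unseen c∉d _ _) (seen c∈d _) = ⊥-elim (c∉d c∈d)
    visitAll-deterministic (unseen _ a a′) (unseen _ b b′)
      with refl , refl ← visit-deterministic a b
      with refl , refl ← visitAll-deterministic a′ b′ = refl , refl

    visit-extends : ∀ {v d d′ o} → Visit G v d d′ o → ∃ λ e → d′ ≡ d ++ e
    visitAll-extends : ∀ {cs d d′ o} → VisitAll G cs d d′ o → ∃ λ e → d′ ≡ d ++ e
    visit-extends {v} {d} (visit a _) with e , refl ← visitAll-extends a = e ++ [ v ] , ++-assoc d e [ v ]
    visitAll-extends {d = d} [] = [] , sym (++-identityʳ d)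
    visitAll-extends (seen _ a) = visitAll-extends a
    visitAll-extends {d = d} (unseen _ a b)
      with e , refl ← visit-extends a
      with e′ , refl ← visitAll-extends b = e ++ e′ , ++-assoc d e e′

    ∈-extension : ∀ {d d′ : List Node} → (∃ λ e → d′ ≡ d ++ e) → ∀ {x} → x ∈ d → x ∈ d′
    ∈-extension (e , refl) = ∈-++⁺ˡ

    visit-finishes : ∀ {v d d′ o} → Visit G v d d′ o → v ∈ d′
    visit-finishes (visit {d′ = d′} _ _) = ∈-++⁺ʳ d′ (here refl)

    visitAll-finishes : ∀ {cs d d′ o} → VisitAll G cs d d′ o → ∀ {c} → c ∈ cs → c ∈ d′
    visitAll-finishes (seen c∈d a)     (here refl) = ∈-extension (visitAll-extends a) c∈d
    visitAll-finishes (seen _ a)       (there c∈cs) = visitAll-finishes a c∈cs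
    visitAll-finishes (unseen _ a b)   (here refl) = ∈-extension (visitAll-extends b) (visit-finishes a)
    visitAll-finishes (unseen _ _ b)   (there c∈cs) = visitAll-finishes b c∈cs

    visitAll-[] : ∀ {cs d o} → VisitAll G cs d [] o → cs ≡ []
    visitAll-[] {[]}    a = refl
    visitAll-[] {_ ∷ _} a with () ← visitAll-finishes a (here refl)

    visit-closed : ∀ {v d d′ o} → Closed G d → Visit G v d d′ o → Closed G d′
    visitAll-closed : ∀ {cs d d′ o} → Closed G d → VisitAll G cs d d′ o → Closed G d′
    visit-closed closed (visit {d′ = d′} a _) x∈d c∈Gx with ∈-++⁻ d′ x∈d
    ... | inj₁ x∈d′       = ∈-++⁺ˡ (visitAll-closed closed a x∈d′ c∈Gx)
    ... | inj₂ (here refl) = ∈-++⁺ˡ (visitAll-finishes a c∈Gx)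
    visitAll-closed closed []             = closed
    visitAll-closed closed (seen _ a)     = visitAll-closed closed a
    visitAll-closed closed (unseen _ a b) = visitAll-closed (visit-closed closed a) b

    visit-unique : ∀ {v d d′ o} → Unique d → Visit G v d d′ o → Unique d′
    visitAll-unique : ∀ {cs d d′ o} → Unique d → VisitAll G cs d d′ o → Unique d′
    visit-unique d! (visit a v∉d′) = Unique-∷ʳ (visitAll-unique d! a) v∉d′
    visitAll-unique d! []             = d!
    visitAll-unique d! (seen _ a)     = visitAll-unique d! a
    visitAll-unique d! (unseen _ a b) = visitAll-unique (visit-unique d! a) b

    visitAll-∷ʳ : ∀ {cs c d d′ d″ o o′} → VisitAll G cs d d′ o → VisitAll G [ c ] d′ d″ o′ →
                  VisitAll G (cs ++ [ c ]) d d″ (o ++ o′)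
    visitAll-∷ʳ []                   b = b
    visitAll-∷ʳ (seen c∈d a)         b = seen c∈d (visitAll-∷ʳ a b)
    visitAll-∷ʳ {o′ = o′} (unseen {o₁ = o₁} {o₂} c∉d a a′) b =
      subst (VisitAll G _ _ _) (sym (++-assoc o₁ o₂ o′)) (unseen c∉d a (visitAll-∷ʳ a′ b))

  module _ {G G′ : OrderedGraph (suc n)} (φ : Node ↔ Node)
           (preserves : ∀ v → G′ (Inverse.to φ v) ≡ map (Inverse.to φ) (G v)) where
    private
      f = Inverse.to φ
      f-injective = Injection.injective (↔⇒↣ φ)

      ∈-map-reflect : ∀ {x d} → f x ∈ map f d → x ∈ d
      ∈-map-reflect fx∈ with y , y∈ , fx≡fy ← ∈-map⁻ f fx∈ = subst (_∈ _) (sym (f-injective fx≡fy)) y∈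

      map-∉ : ∀ {x d} → x ∉ d → f x ∉ map f d
      map-∉ x∉d = x∉d ∘ ∈-map-reflect

    isSource-map : ∀ {s} → IsSource G s → IsSource G′ (f s)
    isSource-map s-source u e = s-source (Inverse.from φ u) (∈-map-reflect (subst (_ ∈_) G′u≡ e))
      where G′u≡ = trans (cong G′ (sym (Inverse.strictlyInverseˡ φ u))) (preserves (Inverse.from φ u))

    visit-map : ∀ {v d d′ o} → Visit G v d d′ o → Visit G′ (f v) (map f d) (map f d′) o
    visitAll-map : ∀ {cs d d′ o} → VisitAll G cs d d′ o → VisitAll G′ (map f cs) (map f d) (map f d′) o
    visit-map {v} (visit {d′ = d′} a v∉d′) =
      subst (λ d → Visit G′ (f v) _ d _) (sym (map-++ f d′ [ v ]))
        (visit (subst (λ cs → VisitAll G′ cs _ _ _) (sym (preserves v)) (visitAll-map a)) (map-∉ v∉d′))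
    visitAll-map [] = []
    visitAll-map {d = d} (seen {c} c∈d a) =
      subst (λ i → VisitAll G′ _ _ _ (H i ∷ _)) (indexOf-map f f-injective d c)
            (seen (∈-map⁺ f c∈d) (visitAll-map a))
    visitAll-map (unseen c∉d a b) = unseen (map-∉ c∉d) (visit-map a) (visitAll-map b)

  initialSegment : ℕ → List Node
  initialSegment = applyUpTo (clamp n)

  ∉-initialSegment : ∀ {b c} → b ≤ c → c ≤ n → clamp n c ∉ initialSegment b
  ∉-initialSegment b≤c c≤n c∈ with i , i<b , same ← ∈-applyUpTo⁻ (clamp n) c∈ =
    <-irrefl i≡c (≤-trans i<b b≤c)
    where
    i≡c = trans (sym (toℕ-clamp n (≤-trans (<⇒≤ i<b) (≤-trans b≤c c≤n))))
                (trans (cong toℕ (sym same)) (toℕ-clamp n c≤n))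

  indexOf-initialSegment : ∀ {i b} → i < b → b ≤ suc n → indexOf (initialSegment b) (clamp n i) ≡ i
  indexOf-initialSegment {i} {suc b} i≤b b<n =
    trans (cong (λ d → indexOf d (clamp n i)) (sym (applyUpTo-∷ʳ (clamp n) b))) (last-or-earlier (i ≟ b))
    where
    last-or-earlier : Dec (i ≡ b) → indexOf (initialSegment b ++ [ clamp n b ]) (clamp n i) ≡ i
    last-or-earlier (yes refl) =
      trans (indexOf-∉ (initialSegment i) [] (∉-initialSegment ≤-refl (≤-pred b<n))) (length-applyUpTo (clamp n) i)
    last-or-earlier (no i≢b)   =
      trans (indexOf-++ (initialSegment b) [ clamp n b ] (∈-applyUpTo⁺ (clamp n) i<b))
            (indexOf-initialSegment i<b (m≤n⇒m≤1+n (≤-pred b<n)))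
      where i<b = ≤∧≢⇒< (≤-pred i≤b) i≢b

  module DepthFirst (G : OrderedGraph (suc n)) (acyclic : IsAcyclic G) where

    _⇝_ : Node → Node → Set
    u ⇝ x = u ≡ x ⊎ TransClosure (Edge G) u x

    NewIn : List Node → List Node → (Node → Set) → Set
    NewIn d d′ P = ∀ {x} → x ∈ d′ → x ∈ d ⊎ P x

    Traversal : Node → List Node → Set
    Traversal v d = Σ (List Node) λ d′ → Σ (List Step) λ o → Visit G v d d′ o × NewIn d d′ (v ⇝_)

    Traversals : List Node → List Node → Set
    Traversals cs d = Σ (List Node) λ d′ → Σ (List Step) λ o →
      VisitAll G cs d d′ o × NewIn d d′ (λ x → ∃ λ c → c ∈ cs × c ⇝ x)

    edge-⇝ : ∀ {v c x} → c ∈ G v → c ⇝ x → TransClosure (Edge G) v x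
    edge-⇝ e (inj₁ refl) = [ e ]⁺
    edge-⇝ e (inj₂ t)    = e ∷⁺ t

    -- v cannot be finished below itself: that would close a cycle through v.
    finish : ∀ {v d} → v ∉ d → Traversals (G v) d → Traversal v d
    finish {v} {d} v∉d (d′ , o , a , new) = d′ ++ [ v ] , o ++ [ U ] , visit a v∉d′ , new′
      where
      v∉d′ : v ∉ d′
      v∉d′ v∈d′ with new v∈d′
      ... | inj₁ v∈d             = v∉d v∈d
      ... | inj₂ (c , c∈Gv , c⇝v) = acyclic v (edge-⇝ c∈Gv c⇝v)

      new′ : NewIn d (d′ ++ [ v ]) (v ⇝_)
      new′ x∈ with ∈-++⁻ d′ x∈
      ... | inj₂ (here refl) = inj₂ (inj₁ refl)
      ... | inj₁ x∈d′ with new x∈d′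
      ... | inj₁ x∈d             = inj₁ x∈d
      ... | inj₂ (c , c∈Gv , c⇝x) = inj₂ (inj₂ (edge-⇝ c∈Gv c⇝x))

    traversals-seen : ∀ {c cs d} → c ∈ d → Traversals cs d → Traversals (c ∷ cs) d
    traversals-seen {d = d} c∈d (d′ , o , a , new) = d′ , _ , seen c∈d a , new′
      where
      new′ : NewIn d d′ _
      new′ x∈ with new x∈
      ... | inj₁ x∈d             = inj₁ x∈d
      ... | inj₂ (c′ , c′∈ , c′⇝x) = inj₂ (c′ , there c′∈ , c′⇝x)

    traversals-unseen : ∀ {c cs d} → c ∉ d → (t : Traversal c d) → Traversals cs (proj₁ t) →
                        Traversals (c ∷ cs) d
    traversals-unseen {d = d} c∉d (d₁ , o₁ , a , new₁) (d₂ , o₂ , b , new₂) =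
      d₂ , o₁ ++ o₂ , unseen c∉d a b , new
      where
      new : NewIn d d₂ _
      new x∈ with new₂ x∈
      ... | inj₂ (c′ , c′∈ , c′⇝x) = inj₂ (c′ , there c′∈ , c′⇝x)
      ... | inj₁ x∈d₁ with new₁ x∈d₁
      ... | inj₁ x∈d = inj₁ x∈d
      ... | inj₂ c⇝x = inj₂ (_ , here refl , c⇝x)

    traversal : ∀ v → Acc (flip (Edge G)) v → ∀ d → v ∉ d → Traversal v d
    traversal v (acc rec) d v∉d = finish v∉d (children (G v) (λ c∈ → c∈) d)
      where
      children : ∀ cs → (∀ {c} → c ∈ cs → c ∈ G v) → ∀ d → Traversals cs d
      children []       _   d = d , [] , [] , inj₁
      children (c ∷ cs) cs⊆ d with c ∈? d
      ... | yes c∈d = traversals-seen c∈d (children cs (cs⊆ ∘ there) d)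
      ... | no  c∉d = let t = traversal c (rec (cs⊆ (here refl))) d c∉d in
                      traversals-unseen c∉d t (children cs (cs⊆ ∘ there) (proj₁ t))

    encoding : ∀ v → ∃₂ λ d o → Visit G v [] d o
    encoding v with d , o , a , _ ← traversal v (AcyclicWalks.acyclic⇒wellFounded (Edge G) acyclic v) [] (λ ()) =
      d , o , a

-- The decoding stack machine

module Machine (j n : ℕ) where
  open Encoding n

  k : ℕ
  k = suc (suc j)

  -- The first node to be created is the sink.
  arity : ℕ → ℕ
  arity zero    = 0
  arity (suc _) = k

  -- Legal ℓ h s: the machine can run s from a state with ℓ created nodes and
  -- h entries on the stack, ending with all n + 1 nodes created and one entry left.
  Legal : ℕ → ℕ → List Step → Set
  Legal ℓ h []        = ℓ ≡ suc n × h ≡ 1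
  Legal ℓ h (H c ∷ s) = c < ℓ × Legal ℓ (suc h) s
  Legal ℓ h (U ∷ s)   = arity ℓ ≤ h × Legal (suc ℓ) (suc (h ∸ arity ℓ)) s

  record State : Set where
    constructor state
    field
      created  : ℕ
      children : ℕ → List ℕ
      stack    : List ℕ
  open State public

  update : ℕ → List ℕ → (ℕ → List ℕ) → ℕ → List ℕ
  update i cs f x with x ≟ i
  ... | yes _ = cs
  ... | no  _ = f x

  update-same : ∀ i cs f → update i cs f i ≡ cs
  update-same i cs f with i ≟ i
  ... | yes _   = refl
  ... | no  i≢i = ⊥-elim (i≢i refl)

  update-other : ∀ i cs f {x} → x ≢ i → update i cs f x ≡ f x
  update-other i cs f {x} x≢i with x ≟ i
  ... | yes x≡i = ⊥-elim (x≢i x≡i)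
  ... | no  _   = refl

  -- H c pushes the node c; U creates a node whose children are the top
  -- arity-many stack entries (the deepest one first) and replaces them by it.
  step : Step → State → State
  step (H c) (state a f s) = state a f (c ∷ s)
  step U     (state a f s) = state (suc a) (update a (reverse (take (arity a) s)) f) (a ∷ drop (arity a) s)

  run : List Step → State → State
  run []       σ = σ
  run (x ∷ xs) σ = run xs (step x σ)

  run-++ : ∀ s t σ → run (s ++ t) σ ≡ run t (run s σ)
  run-++ []      t σ = refl
  run-++ (x ∷ s) t σ = run-++ s t (step x σ)

  step-U : ∀ σ cs rest → arity (created σ) ≡ length cs → stack σ ≡ reverse cs ++ rest →
           step U σ ≡ state (suc (created σ)) (update (created σ) cs (children σ)) (created σ ∷ rest)
  step-U (state a f s) cs rest arity≡ refl =
    cong₂ (λ cs′ rest′ → state (suc a) (update a cs′ f) (a ∷ rest′)) popped remaining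
    where
    arity≡′ : arity a ≡ length (reverse cs)
    arity≡′ = trans arity≡ (sym (length-reverse cs))
    popped : reverse (take (arity a) (reverse cs ++ rest)) ≡ cs
    popped = trans (cong (λ i → reverse (take i (reverse cs ++ rest))) arity≡′)
                   (trans (cong reverse (take-length-++ (reverse cs) rest)) (reverse-involutive cs))
    remaining : drop (arity a) (reverse cs ++ rest) ≡ rest
    remaining = trans (cong (λ i → drop i (reverse cs ++ rest)) arity≡′)
                      (drop-length-++ (reverse cs) rest)

  run-preserves-children : ∀ s σ {i} → i < created σ → children (run s σ) i ≡ children σ i
  run-preserves-children []        σ i< = refl
  run-preserves-children (H c ∷ s) σ i< = run-preserves-children s (step (H c) σ) i<
  run-preserves-children (U ∷ s)   σ i< =
    trans (run-preserves-children s (step U σ) (m≤n⇒m≤1+n i<))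
          (update-other (created σ) (reverse (take (arity (created σ)) (stack σ))) (children σ) (<⇒≢ i<))

  legal-created≤ : ∀ {ℓ h} s → Legal ℓ h s → ℓ ≤ suc n
  legal-created≤ []        (refl , _)  = ≤-refl
  legal-created≤ (H c ∷ s) (_ , legal) = legal-created≤ s legal
  legal-created≤ (U ∷ s)   (_ , legal) = m≤n⇒m≤1+n (≤-pred (legal-created≤ s legal))

  initial : State
  initial = state 0 (λ _ → []) []

  decode : List Step → OrderedGraph (suc n)
  decode p x = map (clamp n) (children (run p initial) (toℕ x))

-- The encoding of a relaxed tree is legal and decodes back to the tree

module EncodingTrees (j n : ℕ) (G : OrderedGraph (suc n)) (T : IsRelaxedTree G (suc (suc j))) where
  open Encoding n
  open Machine j n
  open IsRelaxedTree T

  -- Holds along every traversal: the first node finished has no children.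
  SinkFinished : List Node → Set
  SinkFinished d = d ≡ [] ⊎ sink ∈ d

  visit-sinkFinished : ∀ {v d d′ o} → SinkFinished d → Visit G v d d′ o → SinkFinished d′
  visitAll-sinkFinished : ∀ {cs d d′ o} → SinkFinished d → VisitAll G cs d d′ o → SinkFinished d′
  visit-sinkFinished {v} done (visit a _) with visitAll-sinkFinished done a
  ... | inj₂ sink∈ = inj₂ (∈-++⁺ˡ sink∈)
  ... | inj₁ refl  = inj₂ (here (sym (sinkUnique v (visitAll-[] a))))
  visitAll-sinkFinished done []             = done
  visitAll-sinkFinished done (seen _ a)     = visitAll-sinkFinished done a
  visitAll-sinkFinished done (unseen _ a b) = visitAll-sinkFinished (visit-sinkFinished done a) b

  arity-outDegree : ∀ {v d d′ o} → SinkFinished d → VisitAll G (G v) d d′ o → v ∉ d′ →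
                    arity (length d′) ≡ length (G v)
  arity-outDegree {d′ = []} _ a _ rewrite visitAll-[] a = refl
  arity-outDegree {v} {d} {d′ = x ∷ d′} done a v∉d′ with v F.≟ sink
  ... | no  v≢sink = sym (outDegree v v≢sink)
  ... | yes refl   =
    ⊥-elim (sink-impossible done (visitAll-nothing (subst (λ cs → VisitAll G cs d (x ∷ d′) _) isSink a)))
    where
    visitAll-nothing : ∀ {d₁ d₂ o} → VisitAll G [] d₁ d₂ o → d₂ ≡ d₁
    visitAll-nothing [] = refl
    sink-impossible : SinkFinished d → x ∷ d′ ≡ d → ⊥
    sink-impossible (inj₁ refl) ()
    sink-impossible (inj₂ sink∈) refl = v∉d′ sink∈

  legal-+-suc : ∀ {ℓ h s} m → Legal ℓ (suc m + h) s → Legal ℓ (m + suc h) s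
  legal-+-suc {ℓ} {h} {s} m = subst (λ i → Legal ℓ i s) (sym (+-suc m h))

  visit-legal : ∀ {v d d′ o} → SinkFinished d → Visit G v d d′ o →
                ∀ h s → Legal (length d′) (suc h) s → Legal (length d) h (o ++ s)
  visitAll-legal : ∀ {cs d d′ o} → SinkFinished d → VisitAll G cs d d′ o →
                   ∀ h s → Legal (length d′) (length cs + h) s → Legal (length d) h (o ++ s)
  visit-legal {v} done (visit {d′ = d′} {o} a v∉d′) h s legal rewrite ++-assoc o [ U ] s =
    visitAll-legal done a h (U ∷ s) legal-U
    where
    legal-U : Legal (length d′) (length (G v) + h) (U ∷ s)
    legal-U rewrite arity-outDegree done a v∉d′ | m+n∸m≡n (length (G v)) h | sym (length-∷ʳ d′ v) =
      m≤m+n (length (G v)) h , legal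
  visitAll-legal done [] h s legal = legal
  visitAll-legal {d = d} done (seen {cs = cs} c∈d a) h s legal =
    indexOf<length d c∈d , visitAll-legal done a (suc h) s (legal-+-suc (length cs) legal)
  visitAll-legal done (unseen {cs = cs} {o₁ = o₁} {o₂} _ a b) h s legal rewrite ++-assoc o₁ o₂ s =
    visit-legal done a h (o₂ ++ s)
      (visitAll-legal (visit-sinkFinished done a) b (suc h) s (legal-+-suc (length cs) legal))

  -- σ knows the children of every node of d, nodes being named by their index in d.
  Represents : List Node → State → Set
  Represents d σ = created σ ≡ length d ×
                   (∀ {x} → x ∈ d → children σ (indexOf d x) ≡ map (indexOf d) (G x))

  represents-∷ʳ : ∀ {d v σ} rest → Closed G d → v ∉ d → (∀ {c} → c ∈ G v → c ∈ d) → Represents d σ →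
    Represents (d ++ [ v ])
               (state (suc (created σ)) (update (created σ) (map (indexOf d) (G v)) (children σ)) rest)
  represents-∷ʳ {d} {v} {σ} _ closed v∉d children⊆d (created≡ , rep) =
    trans (cong suc created≡) (sym (length-∷ʳ d v)) , rep′
    where
    open ≡-Reasoning
    kids = map (indexOf d) (G v)
    children′ = update (created σ) kids (children σ)
    rep′ : ∀ {x} → x ∈ d ++ [ v ] → children′ (indexOf (d ++ [ v ]) x) ≡ map (indexOf (d ++ [ v ])) (G x)
    rep′ {x} x∈ with ∈-++⁻ d x∈
    ... | inj₁ x∈d = begin
      children′ (indexOf (d ++ [ v ]) x)   ≡⟨ cong children′ (indexOf-++ d [ v ] x∈d) ⟩
      children′ (indexOf d x)              ≡⟨ update-other (created σ) kids (children σ) (<⇒≢ x<created) ⟩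
      children σ (indexOf d x)             ≡⟨ rep x∈d ⟩
      map (indexOf d) (G x)                ≡⟨ map-indexOf-++ d [ v ] (G x) (closed x∈d) ⟨
      map (indexOf (d ++ [ v ])) (G x)     ∎
      where x<created = subst (indexOf d x <_) (sym created≡) (indexOf<length d x∈d)
    ... | inj₂ (here refl) = begin
      children′ (indexOf (d ++ [ v ]) v)   ≡⟨ cong children′ (trans (indexOf-∉ d [] v∉d) (sym created≡)) ⟩
      children′ (created σ)                ≡⟨ update-same (created σ) kids (children σ) ⟩
      map (indexOf d) (G v)                ≡⟨ map-indexOf-++ d [ v ] (G v) children⊆d ⟨
      map (indexOf (d ++ [ v ])) (G v)     ∎

  push-index : ∀ d {c i} cs rest → i ≡ indexOf d c →
               reverse (map (indexOf d) cs) ++ i ∷ rest ≡ reverse (map (indexOf d) (c ∷ cs)) ++ rest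
  push-index d {c} cs rest refl = sym (reverse-∷-++ (indexOf d c) (map (indexOf d) cs) rest)

  visit-run : ∀ {v d d′ o} → Closed G d → SinkFinished d → Visit G v d d′ o → ∀ σ → Represents d σ →
              Represents d′ (run o σ) × stack (run o σ) ≡ indexOf d′ v ∷ stack σ
  visitAll-run : ∀ {cs d d′ o} → Closed G d → SinkFinished d → VisitAll G cs d d′ o → ∀ σ → Represents d σ →
                 Represents d′ (run o σ) × stack (run o σ) ≡ reverse (map (indexOf d′) cs) ++ stack σ
  visit-run {v} closed done (visit {d′ = d′} {o} a v∉d′) σ rep
    with rep′ , stack≡ ← visitAll-run closed done a σ rep =
    subst (λ τ → Represents (d′ ++ [ v ]) τ × stack τ ≡ indexOf (d′ ++ [ v ]) v ∷ stack σ) (sym run≡)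
      ( represents-∷ʳ {σ = run o σ} (created (run o σ) ∷ stack σ) (visitAll-closed closed a) v∉d′
                      (visitAll-finishes a) rep′
      , cong (_∷ stack σ) (trans (proj₁ rep′) (sym (indexOf-∉ d′ [] v∉d′))))
    where
    arity≡ : arity (created (run o σ)) ≡ length (map (indexOf d′) (G v))
    arity≡ = trans (cong arity (proj₁ rep′)) (trans (arity-outDegree done a v∉d′) (sym (length-map _ (G v))))
    run≡ : run (o ++ [ U ]) σ ≡ _
    run≡ = trans (run-++ o [ U ] σ) (step-U (run o σ) (map (indexOf d′) (G v)) (stack σ) arity≡ stack≡)
  visitAll-run closed done [] σ rep = rep , refl
  visitAll-run {d = d} closed done (seen {c} {cs} {d′ = d′} c∈d a) σ rep
    with rep′ , stack≡ ← visitAll-run closed done a (step (H (indexOf d c)) σ) rep =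
    rep′ , trans stack≡ (push-index d′ cs (stack σ) index≡)
    where
    index≡ : indexOf d c ≡ indexOf d′ c
    index≡ with e , refl ← visitAll-extends a = sym (indexOf-++ d e c∈d)
  visitAll-run closed done (unseen {c} {cs} {d₁ = d₁} {d₂} {o₁} {o₂} _ a b) σ rep
    with rep₁ , stack₁ ← visit-run closed done a σ rep
    with rep₂ , stack₂ ← visitAll-run (visit-closed closed a) (visit-sinkFinished done a) b (run o₁ σ) rep₁ =
    subst (λ τ → Represents d₂ τ × stack τ ≡ reverse (map (indexOf d₂) (c ∷ cs)) ++ stack σ) (sym (run-++ o₁ o₂ σ))
      (rep₂ , trans stack₂ (trans (cong (reverse (map (indexOf d₂) cs) ++_) stack₁)
                                  (push-index d₂ cs (stack σ) index≡)))
    where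
    index≡ : indexOf d₁ c ≡ indexOf d₂ c
    index≡ with e , refl ← visitAll-extends b = sym (indexOf-++ d₁ e (visit-finishes a))

  open DepthFirst G acyclic using (_⇝_; encoding)

  reachable : ∀ u → Acc (Edge G) u → source ⇝ u
  reachable u (acc rec) with any? (λ p → u ∈? G p)
  ... | no  orphan = inj₁ (sym (sourceUnique u (λ p e → orphan (p , e))))
  ... | yes (p , e) with reachable p (rec e)
  ... | inj₁ refl = inj₂ [ e ]⁺
  ... | inj₂ t    = inj₂ (t ++⁺ [ e ]⁺)

  finished : List Node
  finished = proj₁ (encoding source)

  code : List Step
  code = proj₁ (proj₂ (encoding source))

  code-visit : Visit G source [] finished code
  code-visit = proj₂ (proj₂ (encoding source))

  all-finished : ∀ x → x ∈ finished
  all-finished x with reachable x (AcyclicWalks.acyclic⇒wellFounded (flip (Edge G)) (λ x → acyclic x ∘ flip⁺) x)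
  ... | inj₁ refl = visit-finishes code-visit
  ... | inj₂ t    = closed-⁺ (visit-closed (λ ()) code-visit) (visit-finishes code-visit) t

  open Enumeration finished (visit-unique [] code-visit) all-finished public using (enumeration-length; indexOf≤n; relabelling)

  code-legal : Legal 0 0 code
  code-legal = subst (Legal 0 0) (++-identityʳ code) (visit-legal (inj₁ refl) code-visit 0 [] (enumeration-length , refl))

  decode-code : ∀ v → decode code (Inverse.to relabelling v) ≡ map (Inverse.to relabelling) (G v)
  decode-code v = begin
    map (clamp n) (rebuilt (toℕ (clamp n (indexOf finished v))))
      ≡⟨ cong (map (clamp n) ∘ rebuilt) (toℕ-clamp n (indexOf≤n v)) ⟩
    map (clamp n) (rebuilt (indexOf finished v))
      ≡⟨ cong (map (clamp n)) (proj₂ represents (all-finished v)) ⟩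
    map (clamp n) (map (indexOf finished) (G v))
      ≡⟨ map-∘ (G v) ⟨
    map (clamp n ∘ indexOf finished) (G v)
      ∎
    where
    open ≡-Reasoning
    rebuilt = children (run code initial)
    represents : Represents finished (run code initial)
    represents = proj₁ (visit-run (λ ()) (inj₁ refl) code-visit initial (refl , λ ()))

-- Decoding a legal path yields a relaxed tree

module DecodingTrees (j n : ℕ) where
  open Encoding n
  open Machine j n

  record WellFormed (σ : State) : Set where
    field
      children<        : ∀ {i x} → i < created σ → x ∈ children σ i → x < i
      stack<           : ∀ {x} → x ∈ stack σ → x < created σ
      children-sink    : 0 < created σ → children σ 0 ≡ []
      children-length  : ∀ {i} → 0 < i → i < created σ → length (children σ i) ≡ k
      stacked-or-child : ∀ {i} → i < created σ → i ∈ stack σ ⊎ ∃ λ m → m < created σ × i ∈ children σ m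

  wellFormed-initial : WellFormed initial
  wellFormed-initial = record
    { children< = λ () ; stack< = λ () ; children-sink = λ ()
    ; children-length = λ _ () ; stacked-or-child = λ () }

  wellFormed-H : ∀ σ {c} → c < created σ → WellFormed σ → WellFormed (step (H c) σ)
  wellFormed-H σ c< wf = record
    { children< = children< ; children-sink = children-sink ; children-length = children-length
    ; stack< = λ { (here refl) → c< ; (there x∈) → stack< x∈ }
    ; stacked-or-child = λ i< → map₁ there (stacked-or-child i<) }
    where open WellFormed wf

  module AfterU (σ : State) (arity≤ : arity (created σ) ≤ length (stack σ)) (wf : WellFormed σ) where
    open WellFormed wf
    private
      a = created σ
      s = stack σ
      f′ = children (step U σ)
      popped = reverse (take (arity a) s)

    children<′ : ∀ {i x} → i < suc a → x ∈ f′ i → x < i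
    children<′ {i} i≤a x∈ with i ≟ a
    ... | yes refl = stack< (∈-take (arity a) s (reverse⁻ x∈))
    ... | no  i≢a  = children< (≤∧≢⇒< (≤-pred i≤a) i≢a) x∈

    stack<′ : ∀ {x} → x ∈ a ∷ drop (arity a) s → x < suc a
    stack<′ (here refl) = ≤-refl
    stack<′ (there x∈)  = m≤n⇒m≤1+n (stack< (∈-drop (arity a) s x∈))

    children-sink′ : 0 < suc a → f′ 0 ≡ []
    children-sink′ _ with 0 ≟ a
    ... | yes refl = refl
    ... | no  0≢a  = children-sink (n≢0⇒n>0 (0≢a ∘ sym))

    children-length′ : ∀ {i} → 0 < i → i < suc a → length (f′ i) ≡ k
    children-length′ {i} 0<i i≤a with i ≟ a
    ... | no  i≢a = children-length 0<i (≤∧≢⇒< (≤-pred i≤a) i≢a)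
    children-length′ {suc i} _ _ | yes refl =
      trans (length-reverse (take k s)) (trans (length-take k s) (m≤n⇒m⊓n≡m arity≤))

    stacked-or-child′ : ∀ {i} → i < suc a → i ∈ a ∷ drop (arity a) s ⊎ ∃ λ m → m < suc a × i ∈ f′ m
    stacked-or-child′ {i} i≤a with i ≟ a
    ... | yes refl = inj₁ (here refl)
    ... | no  i≢a with stacked-or-child (≤∧≢⇒< (≤-pred i≤a) i≢a)
    ... | inj₂ (m , m<a , i∈) =
      inj₂ (m , m≤n⇒m≤1+n m<a , subst (i ∈_) (sym (update-other a popped (children σ) (<⇒≢ m<a))) i∈)
    ... | inj₁ i∈s with ∈-take⊎drop (arity a) s i∈s
    ... | inj₂ i∈drop = inj₁ (there i∈drop)
    ... | inj₁ i∈take =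
      inj₂ (a , ≤-refl , subst (i ∈_) (sym (update-same a popped (children σ))) (reverse⁺ i∈take))

  wellFormed-U : ∀ σ → arity (created σ) ≤ length (stack σ) → WellFormed σ → WellFormed (step U σ)
  wellFormed-U σ arity≤ wf = record
    { children< = children<′ ; stack< = stack<′ ; children-sink = children-sink′
    ; children-length = children-length′ ; stacked-or-child = stacked-or-child′ }
    where open AfterU σ arity≤ wf

  wellFormed-run : ∀ s σ → Legal (created σ) (length (stack σ)) s → WellFormed σ →
                   WellFormed (run s σ) × created (run s σ) ≡ suc n × length (stack (run s σ)) ≡ 1
  wellFormed-run []        σ (created≡ , height≡) wf = wf , created≡ , height≡
  wellFormed-run (H c ∷ s) σ (c< , legal)        wf = wellFormed-run s (step (H c) σ) legal (wellFormed-H σ c< wf)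
  wellFormed-run (U ∷ s)   σ (arity≤ , legal)    wf =
    wellFormed-run s (step U σ)
      (subst (λ h → Legal (suc (created σ)) (suc h) s) (sym (length-drop (arity (created σ)) (stack σ))) legal)
      (wellFormed-U σ arity≤ wf)

  module Decoded (p : List Step) (legal : Legal 0 0 p) where

    final : State
    final = run p initial

    private
      invariant = wellFormed-run p initial legal wellFormed-initial

    open WellFormed (proj₁ invariant)

    created-final : created final ≡ suc n
    created-final = proj₁ (proj₂ invariant)

    toℕ<created : ∀ (x : Node) → toℕ x < created final
    toℕ<created x = subst (toℕ x <_) (sym created-final) (toℕ<n x)

    edge-decreasing : ∀ {x y} → Edge (decode p) x y → toℕ y < toℕ x
    edge-decreasing {x} e with i , i∈ , refl ← ∈-map⁻ (clamp n) e =
      subst (_< toℕ x) (sym (toℕ-clamp n (≤-trans (<⇒≤ i<x) (≤-pred (toℕ<n x))))) i<x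
      where i<x = children< (toℕ<created x) i∈

    ⁺-decreasing : ∀ {x y} → TransClosure (Edge (decode p)) x y → toℕ y < toℕ x
    ⁺-decreasing [ e ]⁺   = edge-decreasing e
    ⁺-decreasing (e ∷⁺ t) = <-trans (⁺-decreasing t) (edge-decreasing e)

    edge-from-child : ∀ {m} (x : Node) → m < suc n → toℕ x ∈ children final m → Edge (decode p) (clamp n m) x
    edge-from-child {m} x m≤n x∈ =
      subst (λ i → x ∈ map (clamp n) (children final i)) (sym (toℕ-clamp n (≤-pred m≤n)))
            (subst (_∈ map (clamp n) (children final m)) (clamp-toℕ n x) (∈-map⁺ (clamp n) x∈))

    root : Node
    root = clamp n n

    toℕ-root : toℕ root ≡ n
    toℕ-root = toℕ-clamp n ≤-refl

    root-isSource : IsSource (decode p) root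
    root-isSource u e = <-irrefl refl (≤-trans (subst (_< toℕ u) toℕ-root (edge-decreasing e)) (≤-pred (toℕ<n u)))

    -- The last node created is nobody's child, so it is still on the stack.
    root∈stack : n ∈ stack final
    root∈stack with stacked-or-child (subst (n <_) (sym created-final) ≤-refl)
    ... | inj₁ n∈ = n∈
    ... | inj₂ (m , m< , n∈) =
      ⊥-elim (<-irrefl refl (≤-trans (children< m< n∈) (≤-pred (subst (m <_) created-final m<))))

    stack-singleton : ∀ {x y} → x ∈ stack final → y ∈ stack final → x ≡ y
    stack-singleton x∈ y∈ with stack final | proj₂ (proj₂ invariant)
    ... | _ ∷ [] | _ with here refl ← x∈ | here refl ← y∈ = refl

    source-unique : ∀ v → IsSource (decode p) v → v ≡ root
    source-unique v v-source with stacked-or-child (toℕ<created v)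
    ... | inj₂ (m , m< , v∈) = ⊥-elim (v-source (clamp n m) (edge-from-child v (subst (m <_) created-final m<) v∈))
    ... | inj₁ v∈ = toℕ-injective (trans (stack-singleton v∈ root∈stack) (sym toℕ-root))

    sink-isSink : IsSink (decode p) zero
    sink-isSink = cong (map (clamp n)) (children-sink (subst (0 <_) (sym created-final) (s≤s z≤n)))

    outDegree : ∀ v → ¬ v ≡ zero → length (decode p v) ≡ k
    outDegree zero    v≢0 = ⊥-elim (v≢0 refl)
    outDegree (suc v) _   =
      trans (length-map (clamp n) (children final (toℕ (suc v)))) (children-length (s≤s z≤n) (toℕ<created (suc v)))

    sink-unique : ∀ v → IsSink (decode p) v → v ≡ zero
    sink-unique zero    _          = refl
    sink-unique (suc v) childless with () ← trans (sym (outDegree (suc v) (λ ()))) (cong length childless)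

    decode-isRelaxedTree : IsRelaxedTree (decode p) k
    decode-isRelaxedTree = record
      { acyclic = λ u t → <-irrefl refl (⁺-decreasing t)
      ; source = root ; isSource = root-isSource ; sourceUnique = source-unique
      ; sink = zero ; isSink = sink-isSink ; sinkUnique = sink-unique ; outDegree = outDegree }

-- Encoding a decoded path gives the path back

module EncodingDecoded (j n : ℕ) (p : List Step) where
  open Encoding n
  open Machine j n

  G : OrderedGraph (suc n)
  G = decode p

  final : State
  final = run p initial

  -- Trace a b st o: starting with the first a nodes finished, the output o
  -- finishes the first b nodes and leaves the stack st, each entry of which
  -- comes from an H step or is the root of a complete visit.
  data Trace (a : ℕ) : ℕ → List ℕ → List Step → Set where
    []      : Trace a a [] []
    pointer : ∀ {b st o c} → Trace a b st o → c < b → Trace a b (c ∷ st) (o ++ [ H c ])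
    subtree : ∀ {b st o c o′} → Trace a b st o → b ≤ c → c ≤ n →
              Visit G (clamp n c) (initialSegment b) (initialSegment (suc c)) o′ → Trace a (suc c) (c ∷ st) (o ++ o′)

  trace-≤ : ∀ {a b st o} → Trace a b st o → a ≤ b
  trace-≤ []                  = ≤-refl
  trace-≤ (pointer tr _)      = trace-≤ tr
  trace-≤ (subtree tr b≤c _ _) = ≤-trans (trace-≤ tr) (m≤n⇒m≤1+n b≤c)

  trace-[] : ∀ {a b o} → Trace a b [] o → a ≡ b × o ≡ []
  trace-[] [] = refl , refl

  trace-split : ∀ {a b o} top rest → Trace a b (top ++ rest) o →
                ∃ λ m → ∃₂ λ o₁ o₂ → Trace a m rest o₁ × Trace m b top o₂ × o ≡ o₁ ++ o₂
  trace-split {o = o} [] rest tr = _ , o , [] , tr , [] , sym (++-identityʳ o)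
  trace-split (c ∷ top) rest (pointer tr c<)
    with m , o₁ , o₂ , tr₁ , tr₂ , refl ← trace-split top rest tr =
    m , o₁ , o₂ ++ _ , tr₁ , pointer tr₂ c< , ++-assoc o₁ o₂ _
  trace-split (c ∷ top) rest (subtree tr b≤c c≤n v)
    with m , o₁ , o₂ , tr₁ , tr₂ , refl ← trace-split top rest tr =
    m , o₁ , o₂ ++ _ , tr₁ , subtree tr₂ b≤c c≤n v , ++-assoc o₁ o₂ _

  -- The stack lists the children of the next node in reverse order.
  trace⇒visitAll : ∀ {m b top o} → b ≤ suc n → Trace m b top o →
                   VisitAll G (map (clamp n) (reverse top)) (initialSegment m) (initialSegment b) o
  trace⇒visitAll b≤ [] = []
  trace⇒visitAll {b = b} b≤ (pointer {st = top} {c = c} tr c<b)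
    rewrite unfold-reverse c top | map-++ (clamp n) (reverse top) [ c ] =
    visitAll-∷ʳ (trace⇒visitAll b≤ tr)
      (subst (λ i → VisitAll G [ clamp n c ] _ _ [ H i ]) (indexOf-initialSegment c<b b≤)
             (seen (∈-applyUpTo⁺ (clamp n) c<b) []))
  trace⇒visitAll b≤ (subtree {b = b} {st = top} {c = c} {o′ = o′} tr b≤c c≤n v)
    rewrite unfold-reverse c top | map-++ (clamp n) (reverse top) [ c ] =
    visitAll-∷ʳ (trace⇒visitAll (≤-trans b≤c (m≤n⇒m≤1+n c≤n)) tr)
      (subst (VisitAll G [ clamp n c ] _ _) (++-identityʳ o′) (unseen (∉-initialSegment b≤c c≤n) v []))

  CompleteVisit : List Step → Set
  CompleteVisit = Visit G (clamp n n) [] (initialSegment (suc n))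

  trace-final : ∀ {c o} → Trace 0 (suc n) (c ∷ []) o → CompleteVisit o
  trace-final (pointer tr c<) with () ← proj₁ (trace-[] tr)
  trace-final (subtree tr _ _ v) with refl , refl ← trace-[] tr = v

  trace-U : ∀ σ {o} → created σ ≤ n → children final (created σ) ≡ reverse (take (arity (created σ)) (stack σ)) →
            Trace 0 (created σ) (stack σ) o → Trace 0 (suc (created σ)) (stack (step U σ)) (o ++ [ U ])
  trace-U (state b f st) {o} b≤n children≡ tr
    with m , o₁ , o₂ , tr₁ , tr₂ , refl ←
         trace-split (take (arity b) st) (drop (arity b) st)
                     (subst (λ st → Trace 0 b st o) (sym (take++drop≡id (arity b) st)) tr) =
    subst (Trace 0 (suc b) (b ∷ drop (arity b) st)) (sym (++-assoc o₁ o₂ [ U ]))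
          (subtree tr₁ (trace-≤ tr₂) b≤n visit-b)
    where
    children-b : G (clamp n b) ≡ map (clamp n) (reverse (take (arity b) st))
    children-b = trans (cong (map (clamp n) ∘ children final) (toℕ-clamp n b≤n)) (cong (map (clamp n)) children≡)
    visit-b : Visit G (clamp n b) (initialSegment m) (initialSegment (suc b)) (o₂ ++ [ U ])
    visit-b = subst (λ d → Visit G (clamp n b) (initialSegment m) d (o₂ ++ [ U ])) (applyUpTo-∷ʳ (clamp n) b)
                (visit (subst (λ cs → VisitAll G cs (initialSegment m) (initialSegment b) o₂) (sym children-b)
                              (trace⇒visitAll (m≤n⇒m≤1+n b≤n) tr₂))
                       (∉-initialSegment ≤-refl b≤n))

  trace-run : ∀ s σ o → run s σ ≡ final → Legal (created σ) (length (stack σ)) s →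
              Trace 0 (created σ) (stack σ) o → CompleteVisit (o ++ s)
  trace-run [] σ o _ (created≡ , height≡) tr with c ∷ [] ← stack σ | refl ← height≡ =
    subst CompleteVisit (sym (++-identityʳ o)) (trace-final (subst (λ b → Trace 0 b _ o) created≡ tr))
  trace-run (H c ∷ s) σ o run≡ (c< , legal) tr =
    subst CompleteVisit (++-assoc o [ H c ] s)
          (trace-run s (step (H c) σ) (o ++ [ H c ]) run≡ legal (pointer tr c<))
  trace-run (U ∷ s) σ o run≡ (_ , legal) tr =
    subst CompleteVisit (++-assoc o [ U ] s)
          (trace-run s (step U σ) (o ++ [ U ]) run≡ legal′ (trace-U σ b≤n children≡ tr))
    where
    b = created σ
    legal′ : Legal (suc b) (length (stack (step U σ))) s
    legal′ = subst (λ h → Legal (suc b) (suc h) s) (sym (length-drop (arity b) (stack σ))) legal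
    b≤n : b ≤ n
    b≤n = ≤-pred (legal-created≤ s legal′)
    children≡ : children final b ≡ reverse (take (arity b) (stack σ))
    children≡ = trans (cong (λ τ → children τ b) (sym run≡))
                  (trans (run-preserves-children s (step U σ) ≤-refl)
                         (update-same b (reverse (take (arity b) (stack σ))) (children σ)))

  visit-decode : Legal 0 0 p → CompleteVisit p
  visit-decode legal = trace-run p initial [] refl legal []

numberOfClasses : ∀ {k n N} {A : Set} → Fin N ↔ A →
  (tree : A → RelaxedTree k n) (invariant : RelaxedTree k n → A) →
  (∀ a → invariant (tree a) ≡ a) → (∀ T → T ≅ tree (invariant T)) →
  (∀ T T′ → T ≅ T′ → invariant T ≡ invariant T′) → NumberOfClasses k n N
numberOfClasses index tree invariant invariant-tree tree-invariant invariant-≅ =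
  tree ∘ to , classify , injective
  where
  open Inverse index
  classify : ∀ T → ∃ λ i → T ≅ tree (to i)
  classify T =
    from (invariant T) , subst (λ a → T ≅ tree a) (sym (strictlyInverseˡ (invariant T))) (tree-invariant T)
  injective : ∀ i i′ → tree (to i) ≅ tree (to i′) → i ≡ i′
  injective i i′ iso = begin
    i                               ≡⟨ strictlyInverseʳ i ⟨
    from (to i)                     ≡⟨ cong from (invariant-tree (to i)) ⟨
    from (invariant (tree (to i)))  ≡⟨ cong from (invariant-≅ _ _ iso) ⟩
    from (invariant (tree (to i′))) ≡⟨ cong from (invariant-tree (to i′)) ⟩
    from (to i′)                    ≡⟨ strictlyInverseʳ i′ ⟩
    i′                              ∎
    where open ≡-Reasoning

-- Relaxed trees and horizontally decorated paths

module Classification (j n : ℕ) where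
  open Encoding n
  open Machine j n
  open Paths j using (isHDPath-irrelevant; validFrom-belowLine)

  K : ℕ
  K = suc j

  K*suc : ∀ y → K * suc y ≡ K * y + K
  K*suc y = trans (*-suc K y) (+-comm K (K * y))

  K*suc+ : ∀ y {e} → K ≤ e → K * suc y + (e ∸ K) ≡ K * y + e
  K*suc+ y {e} K≤e =
    trans (cong (_+ (e ∸ K)) (K*suc y)) (trans (+-assoc (K * y) K (e ∸ K)) (cong (K * y +_) (m+[n∸m]≡n K≤e)))

  K*0+0 : K * 0 + 0 ≡ 0
  K*0+0 = trans (+-identityʳ (K * 0)) (*-zeroʳ K)

  ValidTo : ℕ → ℕ → List Step → Set
  ValidTo x y s = ValidFrom k x y s (K * n) n

  -- At the point (K y + e, y) the stack holds e + 1 entries; the H steps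
  -- may point to any of the y + 1 nodes created so far.
  validTo⇒legal : ∀ s y e → ValidTo (K * y + e) y s → Legal (suc y) (suc e) s
  validTo⇒legal []        y e (_ , x≡ , refl) =
    refl , cong suc (+-cancelˡ-≡ (K * y) e 0 (trans x≡ (sym (+-identityʳ (K * y)))))
  validTo⇒legal (H c ∷ s) y e (_ , c≤y , v) =
    s≤s c≤y , validTo⇒legal s y (suc e) (subst (λ x → ValidTo x y s) (sym (+-suc (K * y) e)) v)
  validTo⇒legal (U ∷ s)   y e (_ , v) =
    s≤s K≤e , validTo⇒legal s (suc y) (e ∸ K) (subst (λ x → ValidTo x (suc y) s) (sym (K*suc+ y K≤e)) v)
    where
    K≤e : K ≤ e
    K≤e = +-cancelˡ-≤ (K * y) K e (subst (_≤ K * y + e) (K*suc y) (validFrom-belowLine s v))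

  legal⇒validTo : ∀ s y e → Legal (suc y) (suc e) s → ValidTo (K * y + e) y s
  legal⇒validTo []        y e (refl , refl) = m≤m+n (K * y) 0 , +-identityʳ (K * n) , refl
  legal⇒validTo (H c ∷ s) y e (c≤y , legal) =
    m≤m+n (K * y) e , ≤-pred c≤y , subst (λ x → ValidTo x y s) (+-suc (K * y) e) (legal⇒validTo s y (suc e) legal)
  legal⇒validTo (U ∷ s)   y e (K≤e , legal) =
    m≤m+n (K * y) e ,
    subst (λ x → ValidTo x (suc y) s) (K*suc+ y (≤-pred K≤e)) (legal⇒validTo s (suc y) (e ∸ K) legal)

  isHDPath⇒legal : ∀ p → IsHDPath k (K * n) n p → Legal 0 0 p
  isHDPath⇒legal (U ∷ s) v = z≤n , validTo⇒legal s 0 0 (subst (λ x → ValidTo x 0 s) (sym K*0+0) v)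

  legal⇒isHDPath : ∀ p → Legal 0 0 p → IsHDPath k (K * n) n p
  legal⇒isHDPath (U ∷ s) (_ , legal) = subst (λ x → ValidTo x 0 s) K*0+0 (legal⇒validTo s 0 0 legal)

  tree : HDPath k (K * n) n → RelaxedTree k n
  tree (p , hd) = decode p , DecodingTrees.Decoded.decode-isRelaxedTree j n p (isHDPath⇒legal p hd)

  encode : RelaxedTree k n → HDPath k (K * n) n
  encode (G , T) = code , legal⇒isHDPath code code-legal
    where open EncodingTrees j n G T

  encode-tree : ∀ P → encode (tree P) ≡ P
  encode-tree P@(p , hd) = Σ-≡-irrelevant isHDPath-irrelevant
    (proj₂ (visit-deterministic (EncodingTrees.code-visit j n (decode p) (proj₂ (tree P)))
                                (EncodingDecoded.visit-decode j n p (isHDPath⇒legal p hd))))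

  tree-encode : ∀ T → T ≅ tree (encode T)
  tree-encode (G , T) = relabelling , decode-code
    where open EncodingTrees j n G T

  encode-≅ : ∀ T T′ → T ≅ T′ → encode T ≡ encode T′
  encode-≅ (G , T) (G′ , T′) (φ , preserves) =
    Σ-≡-irrelevant isHDPath-irrelevant (proj₂ (visit-deterministic moved B.code-visit))
    where
    module A = EncodingTrees j n G T
    module B = EncodingTrees j n G′ T′
    open IsRelaxedTree
    source≡ : Inverse.to φ (source T) ≡ source T′
    source≡ = sourceUnique T′ _ (isSource-map φ preserves (isSource T))
    moved : Visit G′ (source T′) [] (map (Inverse.to φ) A.finished) A.code
    moved = subst (λ v → Visit G′ v [] _ _) source≡ (visit-map φ preserves A.code-visit)

proposition1 : (k : ℕ) → 2 ≤ k → (r : ℕ → ℕ → ℕ)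
    → (∀ n → r n 0 ≡ 1)
    → (∀ n m → n < (k ∸ 1) * m → r n m ≡ 0)
    → (∀ n m → 1 ≤ m → (k ∸ 1) * m ≤ n → r n m ≡ r n (m ∸ 1) + (m + 1) * r (n ∸ 1) m)
    → ((n m : ℕ) → Fin (r n m) ↔ HDPath k n m)
      × ((n : ℕ) → NumberOfClasses k n (r ((k ∸ 1) * n) n))
proposition1 (suc (suc j)) (s≤s (s≤s z≤n)) r r-height0 r-aboveLine r-step = Fin-r↔HDPath , classes
  where
  open Paths.Counting j r r-height0 r-aboveLine r-step using (Fin-r↔HDPath)
  classes : ∀ n → NumberOfClasses (suc (suc j)) n (r (suc j * n) n)
  classes n = numberOfClasses (Fin-r↔HDPath (suc j * n) n) tree encode encode-tree tree-encode encode-≅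
    where open Classification j n
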